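{- For every simple graph $G$ of order $n\ge2$ and every positive integer $t$, $\chi(G)\le \chi\big(S[G,t]\big)\le \chi(G)+1$.
   Context: Let $G$ be a simple graph with vertex set $V=\{1,\dots,n\}$, $n\ge 2$. For $t\ge 1$, the generalized Sierpiński graph $S(G,t)$ has vertex set $V^t$ (words $u_1u_2\cdots u_t$ over $V$), and two words ${\bf u}=u_1\cdots u_t$, ${\bf v}=v_1\cdots v_t$ are adjacent iff there is $i\in\{1,\dots,t\}$ with $u_j=v_j$ for $j<i$, $u_i\neq v_i$ and $u_iv_i\in E(G)$, and $u_j=v_i$, $v_j=u_i$ for all $j>i$. An edge of this kind with $i<t$ is called a linking edge. The generalized Sierpiński gasket $S[G,t]$ is the graph obtained from $S(G,t)$ by contracting all linking edges (so $S[G,1]=G$). $\chi$ denotes chromatic number. -}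

module Defs where

open import Level using (0ℓ)
open import Data.Nat using (ℕ; zero; suc; _≤_; _<_)
open import Data.Fin using (Fin; toℕ)
import Data.Fin as F
open import Data.Product using (Σ; ∃; _×_)
open import Relation.Nullary using (¬_)
open import Relation.Binary using (Decidable)
open import Relation.Binary.PropositionalEquality using (_≡_; _≢_)
open import Relation.Binary.Construct.Closure.Equivalence using (EqClosure)

record SimpleGraph (n : ℕ) : Set₁ where
  field
    Adj    : Fin n → Fin n → Set
    adj?   : Decidable Adj
    sym    : ∀ {u v} → Adj u v → Adj v u
    irrefl : ∀ {u} → ¬ Adj u u

-- A graph whose vertex set is given as a setoid (V, ≈); i.e. the vertices
-- are the ≈-classes.  This is how quotient (contracted) graphs are represented.
record SetoidGraph : Set₁ where
  field
    V    : Set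
    _≈_  : V → V → Set
    Adj  : V → V → Set

record ProperColouring (H : SetoidGraph) (k : ℕ) : Set where
  open SetoidGraph H
  field
    colour   : V → Fin k
    respects : ∀ {x y} → x ≈ y → colour x ≡ colour y
    proper   : ∀ {x y} → Adj x y → colour x ≢ colour y

Colourable : SetoidGraph → ℕ → Set
Colourable H k = ProperColouring H k

IsChromaticNumber : SetoidGraph → ℕ → Set
IsChromaticNumber H k = Colourable H k × (∀ m → Colourable H m → k ≤ m)

asSetoidGraph : ∀ {n} → SimpleGraph n → SetoidGraph
asSetoidGraph {n} G = record { V = Fin n ; _≈_ = _≡_ ; Adj = SimpleGraph.Adj G }

module _ {n : ℕ} (G : SimpleGraph n) (t : ℕ) where
  open SimpleGraph G

  Word : Set
  Word = Fin t → Fin n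

  SAdjAt : Word → Word → Fin t → Set
  SAdjAt u v i =
      (∀ j → j F.< i → u j ≡ v j)
    × u i ≢ v i
    × Adj (u i) (v i)
    × (∀ j → i F.< j → (u j ≡ v i) × (v j ≡ u i))

  SAdj : Word → Word → Set
  SAdj u v = ∃ λ i → SAdjAt u v i

  -- linking edges: those with i < t (1-based), i.e. toℕ i + 1 < t
  LinkAdj : Word → Word → Set
  LinkAdj u v = ∃ λ i → SAdjAt u v i × suc (toℕ i) < t

  -- two words are identified by contraction iff joined by a path of linking edges
  _≈ᴸ_ : Word → Word → Set
  _≈ᴸ_ = EqClosure LinkAdj

  -- Vertices are the ≈ᴸ-classes;
  -- two distinct classes are adjacent iff some edge of S(G,t) joins members of them
  -- (loops are discarded, parallel edges merged).
  SierpinskiGasket : SetoidGraph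
  SierpinskiGasket = record
    { V   = Word
    ; _≈_ = _≈ᴸ_
    ; Adj = λ x y → ¬ (x ≈ᴸ y) × Σ Word (λ x′ → Σ Word (λ y′ → x ≈ᴸ x′ × y ≈ᴸ y′ × SAdj x′ y′))
    }

{-# OPTIONS --safe #-}
-- Only the edges at the last position survive contraction, so a colouring of words that is
-- constant along linking edges and proper on last-position edges is a colouring of S[G,t].
-- Given a proper χ(G)-colouring c of G, colour a word by its last two letters y z: 0 if y = z
-- and 1 + (c y + c z mod χ(G)) otherwise.  A linking edge p a bᵏ ~ p b aᵏ joins two words
-- ending in a repeated letter (k ≥ 2) or swaps the last two letters (k = 1), and on an edge
-- p y z ~ p y z′ the colours differ since translation mod χ(G) is injective; hence
-- χ(S[G,t]) ≤ χ(G) + 1.  Conversely the words x₀⋯x₀v span a copy of G in S[G,t].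
module Submission where

open import Defs
open import Data.Nat using (ℕ; suc; _≤_)
open import Data.Product using (_×_)

open import Data.Nat as ℕ using (zero; _<_; _+_; _∸_; _%_; s≤s; s≤s⁻¹; NonZero)
import Data.Nat.Properties as ℕ
open import Data.Nat.DivMod using (m%n<n; m<n⇒m%n≡m; %-distribˡ-+; [m+kn]%n≡m%n)
open import Data.Fin as Fin using (Fin; toℕ; fromℕ; fromℕ<; inject₁; _≟_)
import Data.Fin.Properties as Fin
open import Data.Vec.Functional using (updateAt)
open import Data.Vec.Functional.Properties using (updateAt-updates; updateAt-minimal)
open import Data.Product using (_,_; proj₁; proj₂)
open import Data.Sum as Sum using (_⊎_; inj₁; inj₂)
open import Data.Empty using (⊥-elim)
open import Function using (_∘_; case_of_)
open import Relation.Nullary using (¬_; yes; no)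
open import Relation.Binary.PropositionalEquality
open import Relation.Binary.Construct.Closure.ReflexiveTransitive using (ε; _◅_; _◅◅_)
open import Relation.Binary.Construct.Closure.Symmetric using (fwd)
import Relation.Binary.Construct.Closure.Equivalence as EqClosure

[m+o]%d≡[n+o]%d⇒m≡n : ∀ {d} .{{_ : NonZero d}} {m n} o → o ≤ d → m < d → n < d →
                      (m + o) % d ≡ (n + o) % d → m ≡ n
[m+o]%d≡[n+o]%d⇒m≡n {d} {m} {n} o o≤d m<d n<d eq = begin
  m                                 ≡⟨ m<n⇒m%n≡m m<d ⟨
  m % d                             ≡⟨ undo m ⟩
  ((m + o) % d + (d ∸ o) % d) % d   ≡⟨ cong (λ k → (k + (d ∸ o) % d) % d) eq ⟩
  ((n + o) % d + (d ∸ o) % d) % d   ≡⟨ undo n ⟨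
  n % d                             ≡⟨ m<n⇒m%n≡m n<d ⟩
  n                                 ∎
  where
  open ≡-Reasoning
  undo : ∀ k → k % d ≡ ((k + o) % d + (d ∸ o) % d) % d
  undo k = begin
    k % d                   ≡⟨ [m+kn]%n≡m%n k 1 d ⟨
    (k + 1 ℕ.* d) % d       ≡⟨ cong (λ x → (k + x) % d) (ℕ.*-identityˡ d) ⟩
    (k + d) % d             ≡⟨ cong (λ x → (k + x) % d) (ℕ.m+[n∸m]≡n o≤d) ⟨
    (k + (o + (d ∸ o))) % d ≡⟨ cong (_% d) (ℕ.+-assoc k o (d ∸ o)) ⟨
    (k + o + (d ∸ o)) % d   ≡⟨ %-distribˡ-+ (k + o) (d ∸ o) d ⟩
    ((k + o) % d + (d ∸ o) % d) % d ∎

module _ {d : ℕ} where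

  infixl 6 _⊕_

  _⊕_ : Fin (suc d) → Fin (suc d) → Fin (suc d)
  x ⊕ y = fromℕ< (m%n<n (toℕ x + toℕ y) (suc d))

  toℕ-⊕ : ∀ x y → toℕ (x ⊕ y) ≡ (toℕ x + toℕ y) % suc d
  toℕ-⊕ x y = Fin.toℕ-fromℕ< _

  ⊕-comm : ∀ x y → x ⊕ y ≡ y ⊕ x
  ⊕-comm x y = Fin.toℕ-injective (begin
    toℕ (x ⊕ y)                ≡⟨ toℕ-⊕ x y ⟩
    (toℕ x + toℕ y) % suc d    ≡⟨ cong (_% suc d) (ℕ.+-comm (toℕ x) (toℕ y)) ⟩
    (toℕ y + toℕ x) % suc d    ≡⟨ toℕ-⊕ y x ⟨
    toℕ (y ⊕ x)                ∎)
    where open ≡-Reasoning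

  ⊕-cancelˡ : ∀ z {x y} → z ⊕ x ≡ z ⊕ y → x ≡ y
  ⊕-cancelˡ z {x} {y} eq = Fin.toℕ-injective
    ([m+o]%d≡[n+o]%d⇒m≡n (toℕ z) (ℕ.<⇒≤ (Fin.toℕ<n z)) (Fin.toℕ<n x) (Fin.toℕ<n y) (begin
      (toℕ x + toℕ z) % suc d  ≡⟨ toℕ-⊕ x z ⟨
      toℕ (x ⊕ z)              ≡⟨ cong toℕ (trans (⊕-comm x z) (trans eq (⊕-comm z y))) ⟩
      toℕ (y ⊕ z)              ≡⟨ toℕ-⊕ y z ⟩
      (toℕ y + toℕ z) % suc d  ∎))
    where open ≡-Reasoning

≤⇒<⊎≡ : ∀ {m} {i j : Fin m} → i Fin.≤ j → i Fin.< j ⊎ i ≡ j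
≤⇒<⊎≡ = Sum.map₂ Fin.toℕ-injective ∘ ℕ.m≤n⇒m<n∨m≡n

<fromℕ⊎≡fromℕ : ∀ {s} (i : Fin (suc s)) → i Fin.< fromℕ s ⊎ i ≡ fromℕ s
<fromℕ⊎≡fromℕ i = ≤⇒<⊎≡ (Fin.≤fromℕ i)

linking⇒<fromℕ : ∀ {s} {i : Fin (suc s)} → suc (toℕ i) < suc s → i Fin.< fromℕ s
linking⇒<fromℕ {s} {i} h = subst (toℕ i <_) (sym (Fin.toℕ-fromℕ s)) (s≤s⁻¹ h)

<fromℕ⇒linking : ∀ {s} {i : Fin (suc s)} → i Fin.< fromℕ s → suc (toℕ i) < suc s
<fromℕ⇒linking {s} {i} h = s≤s (subst (toℕ i <_) (Fin.toℕ-fromℕ s) h)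

penultimate : ∀ s → Fin (suc (suc s))
penultimate s = inject₁ (fromℕ s)

penultimate<fromℕ : ∀ s → penultimate s Fin.< fromℕ (suc s)
penultimate<fromℕ s = Fin.≤̄⇒inject₁< Fin.≤-refl

<fromℕ⇒<penultimate⊎≡penultimate : ∀ {s} {i : Fin (suc (suc s))} →
  i Fin.< fromℕ (suc s) → i Fin.< penultimate s ⊎ i ≡ penultimate s
<fromℕ⇒<penultimate⊎≡penultimate = ≤⇒<⊎≡ ∘ Fin.<⇒≤pred

module _ {n : ℕ} (G : SimpleGraph n) where
  open SimpleGraph G using (Adj; irrefl)

  gasketEdge⇒finalEdge : ∀ {s} {x y x′ y′ : Word G (suc s)} {i} →
    ¬ _≈ᴸ_ G (suc s) x y → _≈ᴸ_ G (suc s) x x′ → _≈ᴸ_ G (suc s) y y′ →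
    SAdjAt G (suc s) x′ y′ i → i ≡ fromℕ s
  gasketEdge⇒finalEdge {s} {i = i} x≉y x≈x′ y≈y′ e with <fromℕ⊎≡fromℕ i
  ... | inj₂ i≡last = i≡last
  ... | inj₁ i<last = ⊥-elim (x≉y (x≈x′ ◅◅ fwd (i , e , <fromℕ⇒linking i<last) ◅ ε
                                         ◅◅ EqClosure.symmetric (LinkAdj G (suc s)) y≈y′))

  record LinkInvariantColouring (s k : ℕ) : Set where
    field
      colour         : Word G (suc s) → Fin k
      link-invariant : ∀ {u v} → LinkAdj G (suc s) u v → colour u ≡ colour v
      final-proper   : ∀ {u v} → SAdjAt G (suc s) u v (fromℕ s) → colour u ≢ colour v

    respects-≈ᴸ : ∀ {u v} → _≈ᴸ_ G (suc s) u v → colour u ≡ colour v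
    respects-≈ᴸ = EqClosure.gfold isEquivalence colour link-invariant

    finalEdge-separates : ∀ {u v} → SAdjAt G (suc s) u v (fromℕ s) → ¬ _≈ᴸ_ G (suc s) u v
    finalEdge-separates e = final-proper e ∘ respects-≈ᴸ

    gasketColouring : ProperColouring (SierpinskiGasket G (suc s)) k
    gasketColouring = record { colour = colour ; respects = respects-≈ᴸ ; proper = proper }
      where
      proper : ∀ {x y} → SetoidGraph.Adj (SierpinskiGasket G (suc s)) x y → colour x ≢ colour y
      proper (x≉y , x′ , y′ , x≈x′ , y≈y′ , i , e) with gasketEdge⇒finalEdge x≉y x≈x′ y≈y′ e
      ... | refl = λ eq →
        final-proper e (trans (sym (respects-≈ᴸ x≈x′)) (trans eq (respects-≈ᴸ y≈y′)))

  module SuffixColouring {a : ℕ} (C : ProperColouring (asSetoidGraph G) (suc a)) where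
    open ProperColouring C renaming (colour to c; proper to c-proper)

    pairColour : Fin n → Fin n → Fin (suc (suc a))
    pairColour y z with y ≟ z
    ... | yes _ = Fin.zero
    ... | no _  = Fin.suc (c y ⊕ c z)

    pairColour-diag : ∀ y → pairColour y y ≡ Fin.zero
    pairColour-diag y with y ≟ y
    ... | yes _  = refl
    ... | no y≢y = ⊥-elim (y≢y refl)

    pairColour-comm : ∀ y z → pairColour y z ≡ pairColour z y
    pairColour-comm y z with y ≟ z | z ≟ y
    ... | yes _   | yes _   = refl
    ... | yes y≡z | no z≢y  = ⊥-elim (z≢y (sym y≡z))
    ... | no y≢z  | yes z≡y = ⊥-elim (y≢z (sym z≡y))
    ... | no _    | no _    = cong Fin.suc (⊕-comm (c y) (c z))

    pairColour-properʳ : ∀ x {y z} → Adj y z → pairColour x y ≢ pairColour x z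
    pairColour-properʳ x {y} {z} y~z with x ≟ y | x ≟ z
    ... | yes refl | yes refl = λ _ → irrefl y~z
    ... | yes _    | no _     = λ ()
    ... | no _     | yes _    = λ ()
    ... | no _     | no _     = c-proper y~z ∘ ⊕-cancelˡ (c x) ∘ Fin.suc-injective

    colour : ∀ {s} → Word G (suc s) → Fin (suc (suc a))
    colour {zero}  w = Fin.suc (c (w Fin.zero))
    colour {suc s} w = pairColour (w (penultimate s)) (w (fromℕ (suc s)))

    link-invariant : ∀ {s u v} → LinkAdj G (suc s) u v → colour u ≡ colour v
    link-invariant {zero} (_ , _ , s≤s ())
    link-invariant {suc s} {u} {v} (i , (_ , _ , _ , after) , linking)
      with <fromℕ⇒<penultimate⊎≡penultimate (linking⇒<fromℕ linking)
    ... | inj₁ i<pen = begin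
      pairColour (u pen) (u last)  ≡⟨ cong₂ pairColour (proj₁ pen-swapped) (proj₁ last-swapped) ⟩
      pairColour (v i) (v i)       ≡⟨ pairColour-diag (v i) ⟩
      Fin.zero                     ≡⟨ pairColour-diag (u i) ⟨
      pairColour (u i) (u i)       ≡⟨ cong₂ pairColour (proj₂ pen-swapped) (proj₂ last-swapped) ⟨
      pairColour (v pen) (v last)  ∎
      where
      open ≡-Reasoning
      pen = penultimate s
      last = fromℕ (suc s)
      pen-swapped = after pen i<pen
      last-swapped = after last (Fin.<-trans i<pen (penultimate<fromℕ s))
    ... | inj₂ refl = begin
      pairColour (u pen) (u last)  ≡⟨ cong (pairColour (u pen)) (proj₁ last-swapped) ⟩
      pairColour (u pen) (v pen)   ≡⟨ pairColour-comm (u pen) (v pen) ⟩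
      pairColour (v pen) (u pen)   ≡⟨ cong (pairColour (v pen)) (proj₂ last-swapped) ⟨
      pairColour (v pen) (v last)  ∎
      where
      open ≡-Reasoning
      pen = penultimate s
      last = fromℕ (suc s)
      last-swapped = after last (penultimate<fromℕ s)

    final-proper : ∀ {s u v} → SAdjAt G (suc s) u v (fromℕ s) → colour u ≢ colour v
    final-proper {zero} (_ , _ , u~v , _) = c-proper u~v ∘ Fin.suc-injective
    final-proper {suc s} {u} {v} (before , _ , u~v , _) eq =
      pairColour-properʳ (u pen) u~v (trans eq (cong (λ x → pairColour x (v last)) same-pen))
      where
      pen = penultimate s
      last = fromℕ (suc s)
      same-pen = sym (before pen (penultimate<fromℕ s))

  suffixColouring : ∀ {a s} → ProperColouring (asSetoidGraph G) (suc a) →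
                    LinkInvariantColouring s (suc (suc a))
  suffixColouring C = record { SuffixColouring C }

  identityColouring : ProperColouring (asSetoidGraph G) n
  identityColouring = record
    { colour   = λ v → v
    ; respects = λ u≡v → u≡v
    ; proper   = λ {u} u~v u≡v → irrefl (subst (Adj u) (sym u≡v) u~v)
    }

module _ {m : ℕ} (G : SimpleGraph (suc m)) {s : ℕ} where
  open SimpleGraph G using (Adj; irrefl)

  colourable⇒gasketColourable : ∀ {a} → Colourable (asSetoidGraph G) a →
                                Colourable (SierpinskiGasket G (suc s)) (suc a)
  colourable⇒gasketColourable {zero}  C = case ProperColouring.colour C Fin.zero of λ ()
  colourable⇒gasketColourable {suc _} C =
    LinkInvariantColouring.gasketColouring (suffixColouring G C)

  endingIn : Fin (suc m) → Word G (suc s)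
  endingIn v = updateAt (λ _ → Fin.zero) (fromℕ s) (λ _ → v)

  endingIn-last : ∀ v → endingIn v (fromℕ s) ≡ v
  endingIn-last v = updateAt-updates (fromℕ s) (λ _ → Fin.zero)

  endingIn-finalEdge : ∀ {u v} → Adj u v → SAdjAt G (suc s) (endingIn u) (endingIn v) (fromℕ s)
  endingIn-finalEdge {u} {v} u~v =
      (λ j j<last → trans (updateAt-minimal j (fromℕ s) _ (Fin.<⇒≢ j<last))
                          (sym (updateAt-minimal j (fromℕ s) _ (Fin.<⇒≢ j<last))))
    , (λ eq → irrefl (subst (λ x → Adj x _) eq u~v′))
    , u~v′
    , (λ j last<j → ⊥-elim (ℕ.<⇒≱ last<j (Fin.≤fromℕ j)))
    where
    u~v′ : Adj (endingIn u (fromℕ s)) (endingIn v (fromℕ s))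
    u~v′ = subst₂ Adj (sym (endingIn-last u)) (sym (endingIn-last v)) u~v

  -- The two words stay apart after contraction: the suffix colouring built from the trivial
  -- colouring of G separates them.
  endingIn-gasketEdge : ∀ {u v} → Adj u v →
                        SetoidGraph.Adj (SierpinskiGasket G (suc s)) (endingIn u) (endingIn v)
  endingIn-gasketEdge u~v =
    LinkInvariantColouring.finalEdge-separates (suffixColouring G (identityColouring G)) e ,
    _ , _ , ε , ε , fromℕ s , e
    where e = endingIn-finalEdge u~v

  gasketColourable⇒colourable : ∀ {k} → Colourable (SierpinskiGasket G (suc s)) k →
                                Colourable (asSetoidGraph G) k
  gasketColourable⇒colourable K = record
    { colour   = colour ∘ endingIn
    ; respects = cong (colour ∘ endingIn)
    ; proper   = proper ∘ endingIn-gasketEdge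
    }
    where open ProperColouring K

mainTheorem4 : ∀ (n : ℕ) → 2 ≤ n → (G : SimpleGraph n) → (t : ℕ) → 1 ≤ t →
    ∀ (a b : ℕ) → IsChromaticNumber (asSetoidGraph G) a →
    IsChromaticNumber (SierpinskiGasket G t) b →
    (a ≤ b) × (b ≤ suc a)
mainTheorem4 (suc _) (s≤s _) G (suc _) (s≤s _) a b (colG , minG) (colS , minS) =
  minG b (gasketColourable⇒colourable G colS) , minS (suc a) (colourable⇒gasketColourable G colG)
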